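{- For any integers $k \geq 2$, $\beta,n,\rho \geq 0$ and $\alpha > 0$, $$C^k_{n,(\alpha,\beta),\rho} = \begin{cases} C^k_{n,(\alpha-1,\beta-1)} & \text{ if } \rho=0,\\[4pt] \displaystyle{\sum_{i=0}^{n-\rho} C^k_{i,(\alpha-1,k-2)} \, R_{k,\beta+(\rho-1)(k-1)}(n-\rho-i)} & \text{ if } \rho >0. \end{cases}$$
   Context: For an integer $k\ge 2$ and integers $\alpha,\beta, n\ge 0$, let $\mathcal{D}^k_{n,(\alpha,\beta)}$ be the set of integer lattice paths from $(0,\alpha)$ to $(kn+\beta-\alpha,\beta)$ using steps $U=(1,1)$ and $D=(1,1-k)$ that stay weakly above the line $y=0$ (such paths have exactly $n$ steps $D$; the empty path is included when $n=0$, $\alpha=\beta$), and $C^k_{n,(\alpha,\beta)}=|\mathcal{D}^k_{n,(\alpha,\beta)}|$ (set to $0$ if $\alpha<0$ or $\beta<0$). A return to ground is a $D$ step whose right endpoint lies on $y=0$; $C^k_{n,(\alpha,\beta),\rho}$ is the number of paths in $\mathcal{D}^k_{n,(\alpha,\beta)}$ with exactly $\rho$ returns to ground. For $r\ge0$, $R_{k,r}(m)=[t^m]C_k(t)^r$, where $C_k(t)=\sum_{n\ge0} \frac{1}{kn+1}\binom{kn+1}{n} t^n$; for $r\ge1$ this Raney number equals $\frac{r}{km+r}\binom{km+r}{m}$. -}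

module Defs where

open import Data.Nat using (ℕ; zero; suc; _+_; _*_; _∸_; _≤ᵇ_; _≡ᵇ_)
open import Data.Nat.DivMod using (_/_)
open import Data.Nat.Combinatorics using (_C_)
open import Data.Bool using (Bool; true; false; _∧_; if_then_else_)
open import Data.List using (List; []; _∷_; map; _++_; upTo; length; filter)
open import Data.Nat.ListAction using (sum)
open import Data.Integer using (ℤ; +_; -[1+_])
open import Relation.Binary.PropositionalEquality using (_≡_)

-- Steps of a lattice path: U = (1,1), D = (1,1-k).
data Step : Set where
  U D : Step

allPaths : ℕ → List (List Step)
allPaths zero = [] ∷ []
allPaths (suc l) = map (U ∷_) (allPaths l) ++ map (D ∷_) (allPaths l)

valid : ℕ → ℕ → ℕ → ℕ → List Step → Bool
valid k h β zero [] = h ≡ᵇ β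
valid k h β (suc n) [] = false
valid k h β n (U ∷ p) = valid k (suc h) β n p
valid k h β zero (D ∷ p) = false
valid k h β (suc n) (D ∷ p) = ((k ∸ 1) ≤ᵇ h) ∧ valid k (h ∸ (k ∸ 1)) β n p

returns : ℕ → ℕ → List Step → ℕ
returns k h [] = 0
returns k h (U ∷ p) = returns k (suc h) p
returns k h (D ∷ p) = (if (h ∸ (k ∸ 1)) ≡ᵇ 0 then 1 else 0) + returns k (h ∸ (k ∸ 1)) p

-- The set 𝒟^k_{n,(α,β)}: paths from (0,α) to (kn+β-α, β); they have
-- length kn+β-α (if kn+β < α the set is empty, which `valid` enforces).
𝒟 : ℕ → ℕ → ℕ → ℕ → List (List Step)
𝒟 k n α β = filter (λ p → Data.Bool._≟_ (valid k α β n p) true) (allPaths (k * n + β ∸ α))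
  where import Data.Bool

Cn : ℕ → ℕ → ℕ → ℕ → ℕ
Cn k n α β = length (𝒟 k n α β)

Cz : ℕ → ℕ → ℤ → ℤ → ℕ
Cz k n (+ α) (+ β) = Cn k n α β
Cz k n (+ α) -[1+ β ] = 0
Cz k n -[1+ α ] β = 0

Cρ : ℕ → ℕ → ℕ → ℕ → ℕ → ℕ
Cρ k n α β ρ =
  length (filter (λ p → Data.Nat._≟_ (returns k α p) ρ) (𝒟 k n α β))
  where import Data.Nat

-- Fuss–Catalan number [t^n] C_k(t) = (1/(kn+1)) binom(kn+1, n)
fuss : ℕ → ℕ → ℕ
fuss k n = ((k * n + 1) C n) / suc (k * n)

-- R_{k,r}(m) = [t^m] C_k(t)^r, via the Cauchy product
R : ℕ → ℕ → ℕ → ℕ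
R k zero zero = 1
R k zero (suc m) = 0
R k (suc r) m = sum (map (λ j → fuss k j * R k r (m ∸ j)) (upTo (suc m)))

module Submission where

-- Count the paths to a fixed target b by their first step: the number N(h, n) of paths from height h
-- with n down steps satisfies N(h, n) = [h = b, n = 0] + N(h + 1, n) + [h ≥ k − 1] N(h − k + 1, n − 1)
-- and vanishes for h > kn + b, and induction on kn + b − h shows that this determines N. Each
-- decomposition below (at the last visit of a height, at the last step, at the first return to the
-- ground) is proved by checking that the other side satisfies the same recurrence. A path from α > 0
-- without returns is a path from α − 1 to β − 1 lifted by one. A path with ρ > 0 returns splits at its
-- first return into a lifted path from α − 1 to k − 2, a down step, and a path from the ground with
-- ρ − 1 returns. Paths from the ground to r − 1 are counted by R_{k,r}: for r = 1 by the ballot formula,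
-- and in general because the last-visit decomposition turns their counts into convolution powers; this
-- identifies the last factor as R_{k, β + (ρ − 1)(k − 1)}.

open import Defs
open import Data.Bool using (Bool; true; false; if_then_else_; _∧_)
import Data.Bool
open import Data.Bool.Properties using (∧-zeroʳ)
open import Data.Empty using (⊥-elim)
open import Data.List using (List; []; _∷_; _++_; map; filter; length; applyUpTo; upTo)
open import Data.List.Properties using (map-++; map-∘; map-upTo)
open import Data.Nat using (ℕ; zero; suc; _+_; _*_; _∸_; _≤_; _<_; _>_; _≤ᵇ_; _≡ᵇ_; z≤n; s≤s; s≤s⁻¹; z<s; s<s)
open import Data.Nat.Combinatorics using (_C_; nCk+nC[k+1]≡[n+1]C[k+1])
open import Data.Nat.DivMod using (_/_; m*n/n≡m)
open import Data.Nat.ListAction using (sum)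
open import Data.Nat.ListAction.Properties using (sum-++)
open import Data.Nat.Properties
open import Data.Nat.Tactic.RingSolver using (solve-∀)
open import Data.Product using (_×_; _,_)
open import Data.Unit using (⊤; tt)
open import Function using (_∘_)
open import Relation.Binary.Definitions using (tri<; tri≈; tri>)
open import Relation.Binary.PropositionalEquality
  using (_≡_; _≢_; refl; sym; trans; cong; cong₂; subst; subst₂; module ≡-Reasoning)
open import Relation.Nullary using (does; yes; no)
open import Relation.Nullary.Decidable using (dec-true; dec-false)
open import Relation.Nullary.Reflects using (ofʸ)
open import Relation.Unary using (Pred; Decidable)

open ≡-Reasoning

∑ : ℕ → (ℕ → ℕ) → ℕ
∑ n f = sum (applyUpTo f n)

sum-map-upTo : ∀ (f : ℕ → ℕ) n → sum (map f (upTo n)) ≡ ∑ n f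
sum-map-upTo f n = cong sum (map-upTo f n)

∑-cong : ∀ n {f g : ℕ → ℕ} → (∀ j → j < n → f j ≡ g j) → ∑ n f ≡ ∑ n g
∑-cong zero    eq = refl
∑-cong (suc n) eq = cong₂ _+_ (eq 0 z<s) (∑-cong n λ j j<n → eq (suc j) (s<s j<n))

∑-zero : ∀ n {f : ℕ → ℕ} → (∀ j → j < n → f j ≡ 0) → ∑ n f ≡ 0
∑-zero zero    z = refl
∑-zero (suc n) z = cong₂ _+_ (z 0 z<s) (∑-zero n λ j j<n → z (suc j) (s<s j<n))

∑-+ : ∀ n (f g : ℕ → ℕ) → ∑ n (λ j → f j + g j) ≡ ∑ n f + ∑ n g
∑-+ zero    f g = refl
∑-+ (suc n) f g = begin
  f 0 + g 0 + ∑ n (λ j → f (suc j) + g (suc j))   ≡⟨ cong (f 0 + g 0 +_) (∑-+ n (f ∘ suc) (g ∘ suc)) ⟩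
  f 0 + g 0 + (∑ n (f ∘ suc) + ∑ n (g ∘ suc))     ≡⟨ +-assoc (f 0) (g 0) _ ⟩
  f 0 + (g 0 + (∑ n (f ∘ suc) + ∑ n (g ∘ suc)))   ≡⟨ cong (f 0 +_) (x+[y+z]≡y+[x+z] (g 0) (∑ n (f ∘ suc)) (∑ n (g ∘ suc))) ⟩
  f 0 + (∑ n (f ∘ suc) + (g 0 + ∑ n (g ∘ suc)))   ≡⟨ +-assoc (f 0) _ _ ⟨
  f 0 + ∑ n (f ∘ suc) + (g 0 + ∑ n (g ∘ suc))     ∎
  where
  x+[y+z]≡y+[x+z] : ∀ x y z → x + (y + z) ≡ y + (x + z)
  x+[y+z]≡y+[x+z] = solve-∀

∑-split : ∀ m n (f : ℕ → ℕ) → ∑ (m + n) f ≡ ∑ m f + ∑ n (λ j → f (m + j))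
∑-split zero    n f = refl
∑-split (suc m) n f = trans (cong (f 0 +_) (∑-split m n (f ∘ suc))) (sym (+-assoc (f 0) _ _))

infixl 7 _⋆_

_⋆_ : (ℕ → ℕ) → (ℕ → ℕ) → ℕ → ℕ
(f ⋆ g) m = ∑ (suc m) (λ j → f j * g (m ∸ j))

⋆-cong : ∀ {f f′ g g′ : ℕ → ℕ} → (∀ j → f j ≡ f′ j) → (∀ j → g j ≡ g′ j) → ∀ m → (f ⋆ g) m ≡ (f′ ⋆ g′) m
⋆-cong ef eg m = ∑-cong (suc m) λ j _ → cong₂ _*_ (ef j) (eg (m ∸ j))

⋆-distribʳ-+ : ∀ (f₁ f₂ g : ℕ → ℕ) m → ((λ j → f₁ j + f₂ j) ⋆ g) m ≡ (f₁ ⋆ g) m + (f₂ ⋆ g) m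
⋆-distribʳ-+ f₁ f₂ g m =
  trans (∑-cong (suc m) λ j _ → *-distribʳ-+ (g (m ∸ j)) (f₁ j) (f₂ j))
        (∑-+ (suc m) (λ j → f₁ j * g (m ∸ j)) (λ j → f₂ j * g (m ∸ j)))

⋆-shift : ∀ (f g : ℕ → ℕ) ρ t → (∀ j → j < ρ → g j ≡ 0) → (f ⋆ g) (ρ + t) ≡ (f ⋆ (λ s → g (ρ + s))) t
⋆-shift f g ρ t g<ρ≡0 = begin
  ∑ (suc (ρ + t)) summand                                      ≡⟨ cong (λ n → ∑ (suc n) summand) (+-comm ρ t) ⟩
  ∑ (suc t + ρ) summand                                        ≡⟨ ∑-split (suc t) ρ summand ⟩
  ∑ (suc t) summand + ∑ ρ (λ j → summand (suc t + j))         ≡⟨ cong₂ _+_ (∑-cong (suc t) head) (∑-zero ρ tail) ⟩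
  (f ⋆ (λ s → g (ρ + s))) t + 0                                ≡⟨ +-identityʳ _ ⟩
  (f ⋆ (λ s → g (ρ + s))) t                                    ∎
  where
  summand : ℕ → ℕ
  summand j = f j * g (ρ + t ∸ j)
  head : ∀ j → j < suc t → summand j ≡ f j * g (ρ + (t ∸ j))
  head j j<1+t = cong (λ i → f j * g i) (+-∸-assoc ρ (s≤s⁻¹ j<1+t))
  tail : ∀ j → j < ρ → summand (suc t + j) ≡ 0
  tail j j<ρ = begin
    f (suc t + j) * g (ρ + t ∸ (suc t + j)) ≡⟨ cong (λ i → f (suc t + j) * g i) (∸-out j) ⟩
    f (suc t + j) * g (ρ ∸ suc j)           ≡⟨ cong (f (suc t + j) *_) (g<ρ≡0 _ (∸-monoʳ-< z<s j<ρ)) ⟩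
    f (suc t + j) * 0                       ≡⟨ *-zeroʳ (f (suc t + j)) ⟩
    0                                       ∎
    where
    ∸-out : ∀ j → ρ + t ∸ (suc t + j) ≡ ρ ∸ suc j
    ∸-out j = begin
      ρ + t ∸ (suc t + j) ≡⟨ cong (ρ + t ∸_) (sym (+-suc t j)) ⟩
      ρ + t ∸ (t + suc j) ≡⟨ ∸-+-assoc (ρ + t) t (suc j) ⟨
      ρ + t ∸ t ∸ suc j   ≡⟨ cong (_∸ suc j) (m+n∸n≡m ρ t) ⟩
      ρ ∸ suc j           ∎

⋆-as-sum : ∀ (f g : ℕ → ℕ) ρ n → ρ ≤ n →
  sum (map (λ i → f i * g (n ∸ ρ ∸ i)) (upTo (suc n ∸ ρ))) ≡ (f ⋆ g) (n ∸ ρ)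
⋆-as-sum f g ρ n ρ≤n = trans (cong (λ l → sum (map (λ i → f i * g (n ∸ ρ ∸ i)) (upTo l))) (+-∸-assoc 1 ρ≤n))
                             (sum-map-upTo (λ i → f i * g (n ∸ ρ ∸ i)) (suc (n ∸ ρ)))

⋆-R₀ : ∀ k (f : ℕ → ℕ) m → (f ⋆ R k 0) m ≡ f m
⋆-R₀ k f zero    = trans (+-identityʳ (f 0 * 1)) (*-identityʳ (f 0))
⋆-R₀ k f (suc m) = trans (cong (_+ (f ∘ suc ⋆ R k 0) m) (*-zeroʳ (f 0))) (⋆-R₀ k (f ∘ suc) m)

R₀-⋆ : ∀ k (g : ℕ → ℕ) m → (R k 0 ⋆ g) m ≡ g m
R₀-⋆ k g m = trans (cong₂ _+_ (+-identityʳ (g m)) (∑-zero m λ _ _ → refl)) (+-identityʳ (g m))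

R-suc : ∀ k r m → R k (suc r) m ≡ (fuss k ⋆ R k r) m
R-suc k r m = sum-map-upTo (λ j → fuss k j * R k r (m ∸ j)) (suc m)

C-pascal : ∀ n j → suc n C suc j ≡ n C j + n C suc j
C-pascal n j = sym (nCk+nC[k+1]≡[n+1]C[k+1] n j)

C-absorption : ∀ n j → suc j * (suc n C suc j) ≡ suc n * (n C j)
C-absorption zero    zero    = refl
C-absorption zero    (suc j) = *-zeroʳ (suc (suc j))
C-absorption (suc n) zero    = begin
  1 * (suc (suc n) C 1)          ≡⟨ *-identityˡ _ ⟩
  suc (suc n) C 1                ≡⟨ C-pascal (suc n) 0 ⟩
  1 + suc n C 1                  ≡⟨ cong suc (trans (sym (*-identityˡ _)) (C-absorption n 0)) ⟩
  1 + suc n * 1                  ∎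
C-absorption (suc n) (suc j) = begin
  suc (suc j) * (suc (suc n) C suc (suc j))                     ≡⟨ cong (suc (suc j) *_) (C-pascal (suc n) (suc j)) ⟩
  suc (suc j) * (suc n C suc j + suc n C suc (suc j))           ≡⟨ *-distribˡ-+ (suc (suc j)) (suc n C suc j) (suc n C suc (suc j)) ⟩
  suc (suc j) * (suc n C suc j) + suc (suc j) * (suc n C suc (suc j))
      ≡⟨ cong₂ (λ x y → suc n C suc j + x + y) (C-absorption n j) (C-absorption n (suc j)) ⟩
  suc n C suc j + suc n * (n C j) + suc n * (n C suc j)         ≡⟨ +-assoc (suc n C suc j) (suc n * (n C j)) (suc n * (n C suc j)) ⟩
  suc n C suc j + (suc n * (n C j) + suc n * (n C suc j))       ≡⟨ cong (suc n C suc j +_) (*-distribˡ-+ (suc n) (n C j) (n C suc j)) ⟨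
  suc n C suc j + suc n * (n C j + n C suc j)                   ≡⟨ cong (λ x → suc n C suc j + suc n * x) (C-pascal n j) ⟨
  suc (suc n) * (suc n C suc j)                                 ∎

C-ratio : ∀ n j → suc j * (n C suc j) + j * (n C j) ≡ n * (n C j)
C-ratio zero    zero    = refl
C-ratio zero    (suc j) = cong₂ _+_ (*-zeroʳ (suc (suc j))) (*-zeroʳ (suc j))
C-ratio (suc n) zero    = trans (+-identityʳ _) (C-absorption n 0)
C-ratio (suc n) (suc j) = begin
  suc (suc j) * (suc n C suc (suc j)) + suc j * (suc n C suc j) ≡⟨ cong₂ _+_ (C-absorption n (suc j)) (C-absorption n j) ⟩
  suc n * (n C suc j) + suc n * (n C j)                         ≡⟨ +-comm (suc n * (n C suc j)) (suc n * (n C j)) ⟩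
  suc n * (n C j) + suc n * (n C suc j)                         ≡⟨ *-distribˡ-+ (suc n) (n C j) (n C suc j) ⟨
  suc n * (n C j + n C suc j)                                   ≡⟨ cong (suc n *_) (C-pascal n j) ⟨
  suc n * (suc n C suc j)                                       ∎

Cprev : ℕ → ℕ → ℕ
Cprev n zero    = 0
Cprev n (suc j) = n C j

Cprev-pascal : ∀ n j → suc n C j ≡ Cprev n j + n C j
Cprev-pascal n zero    = refl
Cprev-pascal n (suc j) = C-pascal n j

iverson : Bool → ℕ
iverson true  = 1
iverson false = 0

sum-map-cong : ∀ {A : Set} {f g : A → ℕ} → (∀ x → f x ≡ g x) → ∀ xs → sum (map f xs) ≡ sum (map g xs)
sum-map-cong eq []       = refl
sum-map-cong eq (x ∷ xs) = cong₂ _+_ (eq x) (sum-map-cong eq xs)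

sum-map-zero : ∀ {A : Set} {f : A → ℕ} → (∀ x → f x ≡ 0) → ∀ xs → sum (map f xs) ≡ 0
sum-map-zero z []       = refl
sum-map-zero z (x ∷ xs) = cong₂ _+_ (z x) (sum-map-zero z xs)

length-filter≡sum : ∀ {A : Set} (f : A → Bool) xs →
  length (filter (λ x → f x Data.Bool.≟ true) xs) ≡ sum (map (iverson ∘ f) xs)
length-filter≡sum f []       = refl
length-filter≡sum f (x ∷ xs) with f x
... | true  = cong suc (length-filter≡sum f xs)
... | false = length-filter≡sum f xs

length-filter-filter≡sum : ∀ {A : Set} {ℓ} {Q : Pred A ℓ} (Q? : Decidable Q) (f : A → Bool) xs →
  length (filter Q? (filter (λ x → f x Data.Bool.≟ true) xs)) ≡ sum (map (λ x → iverson (does (Q? x) ∧ f x)) xs)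
length-filter-filter≡sum Q? f []       = refl
length-filter-filter≡sum Q? f (x ∷ xs) with f x
... | false = trans (length-filter-filter≡sum Q? f xs) (cong (_+ _) (cong iverson (sym (∧-zeroʳ (does (Q? x))))))
... | true with does (Q? x)
...   | true  = cong suc (length-filter-filter≡sum Q? f xs)
...   | false = length-filter-filter≡sum Q? f xs

sum-map-allPaths : (f : List Step → ℕ) (L : ℕ) →
  sum (map f (allPaths (suc L))) ≡ sum (map (f ∘ (U ∷_)) (allPaths L)) + sum (map (f ∘ (D ∷_)) (allPaths L))
sum-map-allPaths f L = begin
  sum (map f (map (U ∷_) ps ++ map (D ∷_) ps))                ≡⟨ cong sum (map-++ f (map (U ∷_) ps) (map (D ∷_) ps)) ⟩
  sum (map f (map (U ∷_) ps) ++ map f (map (D ∷_) ps))        ≡⟨ sum-++ (map f (map (U ∷_) ps)) _ ⟩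
  sum (map f (map (U ∷_) ps)) + sum (map f (map (D ∷_) ps))   ≡⟨ cong₂ (λ xs ys → sum xs + sum ys) (map-∘ ps) (map-∘ ps) ⟨
  sum (map (f ∘ (U ∷_)) ps) + sum (map (f ∘ (D ∷_)) ps)       ∎
  where
  ps = allPaths L

lift : ℕ → (ℕ → ℕ → ℕ) → ℕ → ℕ → ℕ
lift s F h n = if s ≤ᵇ h then F (h ∸ s) n else 0

lift-≥ : ∀ s F h n → s ≤ h → lift s F h n ≡ F (h ∸ s) n
lift-≥ s F h n s≤h = cong (λ c → if c then F (h ∸ s) n else 0) (dec-true (s ≤? h) s≤h)

lift-below : ∀ s F h n → h < s → lift s F h n ≡ 0
lift-below s F h n h<s = cong (λ c → if c then F (h ∸ s) n else 0) (dec-false (s ≤? h) (<⇒≱ h<s))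

lift-above : ∀ s F x n → lift s F (s + x) n ≡ F x n
lift-above s F x n = trans (lift-≥ s F (s + x) n (m≤m+n s x)) (cong (λ h → F h n) (m+n∸m≡n s x))

module Paths (e : ℕ) where

  k d : ℕ
  k = 2 + e
  d = 1 + e

  reach-suc : ∀ n b → k * suc n + b ≡ suc (k * n + b + d)
  reach-suc n b = lemma e n b
    where
    lemma : ∀ e n b → (2 + e) * suc n + b ≡ suc ((2 + e) * n + b + suc e)
    lemma = solve-∀

  down : (ℕ → ℕ → ℕ) → ℕ → ℕ → ℕ
  down F h zero    = 0
  down F h (suc n) = if d ≤ᵇ h then F (h ∸ d) n else 0

  AtDown : (ℕ → ℕ → Set) → ℕ → ℕ → Set
  AtDown Q h zero    = ⊤
  AtDown Q h (suc n) = d ≤ h → Q (h ∸ d) n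

  atDown : ∀ {Q : ℕ → ℕ → Set} h n → (d ≤ h → ∀ n′ → Q (h ∸ d) n′) → AtDown Q h n
  atDown h zero    q = tt
  atDown h (suc n) q d≤h = q d≤h n

  down-cong : ∀ {F G : ℕ → ℕ → ℕ} h n → AtDown (λ h′ n′ → F h′ n′ ≡ G h′ n′) h n → down F h n ≡ down G h n
  down-cong h zero    _  = refl
  down-cong h (suc n) eq with d ≤ᵇ h | ≤ᵇ-reflects-≤ d h
  ... | true  | ofʸ d≤h = eq d≤h
  ... | false | _       = refl

  down-vanish : ∀ {F : ℕ → ℕ → ℕ} h n → AtDown (λ h′ n′ → F h′ n′ ≡ 0) h n → down F h n ≡ 0
  down-vanish h zero    _ = refl
  down-vanish h (suc n) z with d ≤ᵇ h | ≤ᵇ-reflects-≤ d h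
  ... | true  | ofʸ d≤h = z d≤h
  ... | false | _       = refl

  down-≥ : ∀ F h n → d ≤ h → down F h (suc n) ≡ F (h ∸ d) n
  down-≥ F h n d≤h = cong (λ c → if c then F (h ∸ d) n else 0) (dec-true (d ≤? h) d≤h)

  down-< : ∀ F h n → h < d → down F h (suc n) ≡ 0
  down-< F h n h<d = cong (λ c → if c then F (h ∸ d) n else 0) (dec-false (d ≤? h) (<⇒≱ h<d))

  down-+ : ∀ (F G : ℕ → ℕ → ℕ) h n → down (λ h′ n′ → F h′ n′ + G h′ n′) h n ≡ down F h n + down G h n
  down-+ F G h zero    = refl
  down-+ F G h (suc n) with d ≤ᵇ h
  ... | true  = refl
  ... | false = refl

  beyond-down : ∀ {Q : ℕ → ℕ → Set} b h n → (∀ h′ n′ → k * n′ + b < h′ → Q h′ n′) → k * n + b ≤ h → AtDown Q h n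
  beyond-down b h zero    q _   = tt
  beyond-down b h (suc n) q X≤h _ = q (h ∸ d) n (m+n≤o⇒m≤o∸n (suc (k * n + b)) (subst (_≤ h) (reach-suc n b) X≤h))

  -- The measure k * n + b ∸ h drops by one along both kinds of first step.
  height-induction : (b : ℕ) (Q : ℕ → ℕ → Set)
    → (∀ h n → k * n + b < h → Q h n)
    → (∀ h n → Q (suc h) n → AtDown Q h n → Q h n)
    → ∀ h n → Q h n
  height-induction b Q beyond step h n = go (suc (k * n + b)) h n (m≤n+m (suc (k * n + b)) h)
    where
    go : ∀ M h n → k * n + b < h + M → Q h n
    go zero    h n lt = beyond h n (subst (k * n + b <_) (+-identityʳ h) lt)
    go (suc M) h n lt = step h n (go M (suc h) n (subst (k * n + b <_) (+-suc h M) lt)) (below n lt)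
      where
      below : ∀ n → k * n + b < h + suc M → AtDown Q h n
      below zero    _  = tt
      below (suc n) lt d≤h = go M (h ∸ d) n (subst (k * n + b <_) (+-∸-comm M d≤h)
        (m+n≤o⇒m≤o∸n (suc (k * n + b)) (s≤s⁻¹ (subst₂ _<_ (reach-suc n b) (+-suc h M) lt))))

  -- After a down step to height h, the rest of the path must satisfy P shifted by the return (if any) just made.
  arrive : ℕ → (ℕ → Bool) → ℕ → Bool
  arrive zero    P r = P (suc r)
  arrive (suc _) P r = P r

  accepts : (ℕ → Bool) → ℕ → ℕ → ℕ → List Step → Bool
  accepts P b h n p = P (returns k h p) ∧ valid k h b n p

  countLen : (ℕ → Bool) → ℕ → ℕ → ℕ → ℕ → ℕ
  countLen P b h n L = sum (map (iverson ∘ accepts P b h n) (allPaths L))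

  ends : (ℕ → Bool) → ℕ → ℕ → ℕ → ℕ
  ends P b h n = iverson (P 0 ∧ valid k h b n [])

  count : (ℕ → Bool) → ℕ → ℕ → ℕ → ℕ
  count P b h n = countLen P b h n (k * n + b ∸ h)

  countLen-zero : ∀ P b h n → countLen P b h n 0 ≡ ends P b h n
  countLen-zero P b h n = +-identityʳ _

  countLen-suc : ∀ P b h n L →
    countLen P b h n (suc L) ≡ countLen P b (suc h) n L + down (λ h′ n′ → countLen (arrive h′ P) b h′ n′ L) h n
  countLen-suc P b h n L =
    trans (sum-map-allPaths (iverson ∘ accepts P b h n) L) (cong₂ _+_ (sum-map-cong (up n) (allPaths L)) (downs n))
    where
    up : ∀ n p → iverson (accepts P b h n (U ∷ p)) ≡ iverson (accepts P b (suc h) n p)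
    up zero    p = refl
    up (suc _) p = refl
    downs : ∀ n → sum (map (iverson ∘ accepts P b h n ∘ (D ∷_)) (allPaths L)) ≡ down (λ h′ n′ → countLen (arrive h′ P) b h′ n′ L) h n
    downs zero    = sum-map-zero (λ p → cong iverson (∧-zeroʳ _)) (allPaths L)
    downs (suc n) with d ≤ᵇ h | h ∸ d
    ... | false | _     = sum-map-zero (λ p → cong iverson (∧-zeroʳ _)) (allPaths L)
    ... | true  | zero  = refl
    ... | true  | suc _ = refl

  ends-off : ∀ P b h n → h ≢ k * n + b → ends P b h n ≡ 0
  ends-off P b h zero    h≢X = begin
    iverson (P 0 ∧ (h ≡ᵇ b)) ≡⟨ cong (λ c → iverson (P 0 ∧ c)) (dec-false (h ≟ b) (h≢X ∘ (λ h≡b → trans h≡b k*0+b≡b))) ⟩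
    iverson (P 0 ∧ false)    ≡⟨ cong iverson (∧-zeroʳ (P 0)) ⟩
    0                        ∎
    where
    k*0+b≡b : b ≡ k * 0 + b
    k*0+b≡b = cong (_+ b) (sym (*-zeroʳ k))
  ends-off P b h (suc n) _   = cong iverson (∧-zeroʳ (P 0))

  count-vanish : ∀ P b h n → k * n + b < h → count P b h n ≡ 0
  count-vanish P b h n X<h = begin
    countLen P b h n (k * n + b ∸ h) ≡⟨ cong (countLen P b h n) (m≤n⇒m∸n≡0 (<⇒≤ X<h)) ⟩
    countLen P b h n 0               ≡⟨ countLen-zero P b h n ⟩
    ends P b h n                     ≡⟨ ends-off P b h n (>⇒≢ X<h) ⟩
    0                                ∎

  count-rec : ∀ P b h n → count P b h n ≡
    ends P b h n + count P b (suc h) n + down (λ h′ n′ → count (arrive h′ P) b h′ n′) h n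
  count-rec P b h n with h <? k * n + b
  ... | yes h<X = begin
    countLen P b h n (X ∸ h)                                   ≡⟨ cong (countLen P b h n) (+-∸-assoc 1 h<X) ⟩
    countLen P b h n (suc (X ∸ suc h))                         ≡⟨ countLen-suc P b h n (X ∸ suc h) ⟩
    count P b (suc h) n + down (λ h′ n′ → countLen (arrive h′ P) b h′ n′ (X ∸ suc h)) h n
                                                               ≡⟨ cong (count P b (suc h) n +_) (down-cong h n (lengths n)) ⟩
    count P b (suc h) n + down (λ h′ n′ → count (arrive h′ P) b h′ n′) h n
        ≡⟨ cong (λ x → x + count P b (suc h) n + down (λ h′ n′ → count (arrive h′ P) b h′ n′) h n)
                (ends-off P b h n (<⇒≢ h<X)) ⟨
    ends P b h n + count P b (suc h) n + down (λ h′ n′ → count (arrive h′ P) b h′ n′) h n ∎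
    where
    X = k * n + b
    lengths : ∀ n → AtDown (λ h′ n′ → countLen (arrive h′ P) b h′ n′ (k * n + b ∸ suc h) ≡ count (arrive h′ P) b h′ n′) h n
    lengths zero    = tt
    lengths (suc n) d≤h = cong (countLen (arrive (h ∸ d) P) b (h ∸ d) n) (begin
      k * suc n + b ∸ suc h       ≡⟨ cong (_∸ suc h) (reach-suc n b) ⟩
      k * n + b + d ∸ h           ≡⟨ cong (k * n + b + d ∸_) (m+[n∸m]≡n d≤h) ⟨
      k * n + b + d ∸ (d + (h ∸ d)) ≡⟨ ∸-+-assoc (k * n + b + d) d (h ∸ d) ⟨
      k * n + b + d ∸ d ∸ (h ∸ d) ≡⟨ cong (_∸ (h ∸ d)) (m+n∸n≡m (k * n + b) d) ⟩
      k * n + b ∸ (h ∸ d)         ∎)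
  ... | no h≮X = begin
    countLen P b h n (k * n + b ∸ h) ≡⟨ cong (countLen P b h n) (m≤n⇒m∸n≡0 X≤h) ⟩
    countLen P b h n 0               ≡⟨ countLen-zero P b h n ⟩
    ends P b h n                     ≡⟨ trans (+-identityʳ _) (+-identityʳ _) ⟨
    ends P b h n + 0 + 0             ≡⟨ cong₂ (λ x y → ends P b h n + x + y) (count-vanish P b (suc h) n (s≤s X≤h))
                                               (down-vanish h n (beyond-down b h n (λ h′ n′ → count-vanish (arrive h′ P) b h′ n′) X≤h)) ⟨
    ends P b h n + count P b (suc h) n + down (λ h′ n′ → count (arrive h′ P) b h′ n′) h n ∎
    where
    X≤h : k * n + b ≤ h
    X≤h = ≮⇒≥ h≮X

  paths : ℕ → ℕ → ℕ → ℕ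
  paths = count (λ _ → true)

  pathsᵣ : ℕ → ℕ → ℕ → ℕ → ℕ
  pathsᵣ ρ = count (_≡ᵇ ρ)

  endsAt : ℕ → ℕ → ℕ → ℕ
  endsAt = ends (λ _ → true)

  Cn≡paths : ∀ n h b → Cn k n h b ≡ paths b h n
  Cn≡paths n h b = length-filter≡sum (valid k h b n) (allPaths (k * n + b ∸ h))

  Cρ≡pathsᵣ : ∀ n h b ρ → Cρ k n h b ρ ≡ pathsᵣ ρ b h n
  Cρ≡pathsᵣ n h b ρ = length-filter-filter≡sum (λ p → returns k h p ≟ ρ) (valid k h b n) (allPaths (k * n + b ∸ h))

  paths-vanish : ∀ b h n → k * n + b < h → paths b h n ≡ 0
  paths-vanish = count-vanish (λ _ → true)

  paths-rec : ∀ b h n → paths b h n ≡ endsAt b h n + paths b (suc h) n + down (paths b) h n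
  paths-rec b h n = trans (count-rec (λ _ → true) b h n)
    (cong (endsAt b h n + paths b (suc h) n +_) (down-cong h n (atDown h n λ _ → arrive-true (h ∸ d))))
    where
    arrive-true : ∀ h′ n′ → count (arrive h′ (λ _ → true)) b h′ n′ ≡ paths b h′ n′
    arrive-true zero    n′ = refl
    arrive-true (suc _) n′ = refl

  paths-unique : ∀ b (F : ℕ → ℕ → ℕ)
    → (∀ h n → F h n ≡ endsAt b h n + F (suc h) n + down F h n)
    → (∀ h n → k * n + b < h → F h n ≡ 0)
    → ∀ h n → F h n ≡ paths b h n
  paths-unique b F F-rec F-vanish = height-induction b (λ h n → F h n ≡ paths b h n)
    (λ h n X<h → trans (F-vanish h n X<h) (sym (paths-vanish b h n X<h)))
    λ h n above below → begin
      F h n                                          ≡⟨ F-rec h n ⟩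
      endsAt b h n + F (suc h) n + down F h n        ≡⟨ cong₂ (λ x y → endsAt b h n + x + y) above (down-cong h n below) ⟩
      endsAt b h n + paths b (suc h) n + down (paths b) h n ≡⟨ paths-rec b h n ⟨
      paths b h n                                    ∎

  down-⋆ : ∀ F (g : ℕ → ℕ) h m → (down F h ⋆ g) m ≡ down (λ h′ m′ → (F h′ ⋆ g) m′) h m
  down-⋆ F g h zero    = refl
  down-⋆ F g h (suc m) with d ≤ᵇ h
  ... | true  = refl
  ... | false = ∑-zero (suc m) λ _ _ → refl

  endsAt-⋆ : ∀ a h (g : ℕ → ℕ) m → (endsAt a h ⋆ g) m ≡ iverson (h ≡ᵇ a) * g m
  endsAt-⋆ a h g m = trans (cong (iverson (h ≡ᵇ a) * g m +_) (∑-zero m λ _ _ → refl)) (+-identityʳ _)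

  paths-⋆-rec : ∀ a h (g : ℕ → ℕ) m → (paths a h ⋆ g) m ≡
    iverson (h ≡ᵇ a) * g m + (paths a (suc h) ⋆ g) m + down (λ h′ m′ → (paths a h′ ⋆ g) m′) h m
  paths-⋆-rec a h g m = begin
    (paths a h ⋆ g) m
      ≡⟨ ⋆-cong {g = g} (paths-rec a h) (λ _ → refl) m ⟩
    ((λ j → endsAt a h j + paths a (suc h) j + down (paths a) h j) ⋆ g) m
      ≡⟨ ⋆-distribʳ-+ (λ j → endsAt a h j + paths a (suc h) j) (down (paths a) h) g m ⟩
    ((λ j → endsAt a h j + paths a (suc h) j) ⋆ g) m + (down (paths a) h ⋆ g) m
      ≡⟨ cong₂ _+_ (⋆-distribʳ-+ (endsAt a h) (paths a (suc h)) g m) (down-⋆ (paths a) g h m) ⟩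
    (endsAt a h ⋆ g) m + (paths a (suc h) ⋆ g) m + down (λ h′ m′ → (paths a h′ ⋆ g) m′) h m
      ≡⟨ cong (λ x → x + (paths a (suc h) ⋆ g) m + down (λ h′ m′ → (paths a h′ ⋆ g) m′) h m) (endsAt-⋆ a h g m) ⟩
    iverson (h ≡ᵇ a) * g m + (paths a (suc h) ⋆ g) m + down (λ h′ m′ → (paths a h′ ⋆ g) m′) h m
      ∎

  down-lift : ∀ s F x n → down (lift (suc s) F) (suc s + x) n ≡ down F x n
  down-lift s F x zero    = refl
  down-lift s F x (suc n) with d ≤? x
  ... | yes d≤x = begin
    down (lift (suc s) F) (suc s + x) (suc n) ≡⟨ down-≥ (lift (suc s) F) (suc s + x) n (≤-trans d≤x (m≤n+m x (suc s))) ⟩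
    lift (suc s) F (suc s + x ∸ d) n          ≡⟨ cong (λ h → lift (suc s) F h n) (+-∸-assoc (suc s) d≤x) ⟩
    lift (suc s) F (suc s + (x ∸ d)) n        ≡⟨ lift-above (suc s) F (x ∸ d) n ⟩
    F (x ∸ d) n                               ≡⟨ down-≥ F x n d≤x ⟨
    down F x (suc n)                          ∎
  ... | no d≰x = begin
    down (lift (suc s) F) (suc s + x) (suc n)
      ≡⟨ down-vanish {lift (suc s) F} (suc s + x) (suc n) (λ _ → lift-below (suc s) F (suc s + x ∸ d) n lands-below) ⟩
    0                                         ≡⟨ down-< F x n (≰⇒> d≰x) ⟨
    down F x (suc n)                          ∎
    where
    lands-below : suc s + x ∸ d < suc s
    lands-below = m<n+o⇒m∸n<o (suc s + x) d (subst (suc s + x <_) (+-comm (suc s) d) (+-monoʳ-< (suc s) (≰⇒> d≰x)))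

  endsAt-lift : ∀ s c x n → endsAt (s + c) (s + x) n ≡ endsAt c x n
  endsAt-lift zero    c x n       = refl
  endsAt-lift (suc s) c x zero    = endsAt-lift s c x zero
  endsAt-lift (suc s) c x (suc n) = refl

  below-reach : ∀ a c m → a < k * m + (suc a + c)
  below-reach a c m = ≤-trans (m≤m+n (suc a) c) (m≤n+m (suc a + c) (k * m))

  lift-paths-rec : ∀ a c h m →
    lift (suc a) (paths c) h m + iverson (h ≡ᵇ a) * paths c 0 m ≡
    endsAt (suc a + c) h m + lift (suc a) (paths c) (suc h) m + down (lift (suc a) (paths c)) h m
  lift-paths-rec a c h m with <-cmp h a
  ... | tri< h<a _ _ = begin
    lift (suc a) F h m + iverson (h ≡ᵇ a) * F 0 m
      ≡⟨ cong₂ _+_ (lift-below (suc a) F h m (m<n⇒m<1+n h<a)) (cong (λ c → iverson c * F 0 m) (dec-false (h ≟ a) (<⇒≢ h<a))) ⟩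
    0 + 0 + 0
      ≡⟨ cong₂ _+_ (cong₂ _+_ (ends-off (λ _ → true) (suc a + c) h m (<⇒≢ (<-trans h<a (below-reach a c m))))
                              (lift-below (suc a) F (suc h) m (s<s h<a)))
                   (down-vanish {lift (suc a) F} h m (atDown h m λ _ n′ →
                      lift-below (suc a) F (h ∸ d) n′ (s≤s (≤-trans (m∸n≤m h d) (<⇒≤ h<a))))) ⟨
    endsAt (suc a + c) h m + lift (suc a) F (suc h) m + down (lift (suc a) F) h m ∎
    where F = paths c
  ... | tri≈ _ refl _ = begin
    lift (suc h) F h m + iverson (h ≡ᵇ h) * F 0 m
      ≡⟨ cong₂ _+_ (lift-below (suc h) F h m ≤-refl) (cong (λ c → iverson c * F 0 m) (dec-true (h ≟ h) refl)) ⟩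
    0 + F 0 m + 0
      ≡⟨ cong₂ _+_ (cong₂ _+_ (ends-off (λ _ → true) (suc h + c) h m (<⇒≢ (below-reach h c m)))
                              (trans (cong (λ x → lift (suc h) F x m) (sym (+-identityʳ (suc h)))) (lift-above (suc h) F 0 m)))
                   (down-vanish {lift (suc h) F} h m (atDown h m λ _ n′ → lift-below (suc h) F (h ∸ d) n′ (s≤s (m∸n≤m h d)))) ⟨
    endsAt (suc h + c) h m + lift (suc h) F (suc h) m + down (lift (suc h) F) h m ∎
    where F = paths c
  ... | tri> _ _ a<h with m≤n⇒∃[o]m+o≡n a<h
  ...   | x , refl = begin
    lift (suc a) F (suc a + x) m + iverson (suc a + x ≡ᵇ a) * F 0 m
      ≡⟨ cong₂ _+_ (lift-above (suc a) F x m) (cong (λ c → iverson c * F 0 m) (dec-false (suc a + x ≟ a) (>⇒≢ (m≤m+n (suc a) x)))) ⟩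
    F x m + 0
      ≡⟨ +-identityʳ (F x m) ⟩
    F x m
      ≡⟨ paths-rec c x m ⟩
    endsAt c x m + F (suc x) m + down F x m
      ≡⟨ cong₂ _+_ (cong₂ _+_ (endsAt-lift (suc a) c x m)
                              (trans (cong (λ y → lift (suc a) F y m) (sym (+-suc (suc a) x))) (lift-above (suc a) F (suc x) m)))
                   (down-lift a F x m) ⟨
    endsAt (suc a + c) (suc a + x) m + lift (suc a) F (suc (suc a + x)) m + down (lift (suc a) F) (suc a + x) m ∎
    where F = paths c

  -- Paths that never come down to height a are lifted paths; the others are cut at their last visit to a.
  last-visit : ∀ a c h m → paths (suc a + c) h m ≡ lift (suc a) (paths c) h m + (paths a h ⋆ paths c 0) m
  last-visit a c h m = sym (paths-unique (suc a + c) F F-rec F-vanish h m)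
    where
    L = lift (suc a) (paths c)
    g = paths c 0
    V : ℕ → ℕ → ℕ
    V h m = (paths a h ⋆ g) m
    F : ℕ → ℕ → ℕ
    F h m = L h m + V h m
    F-rec : ∀ h m → F h m ≡ endsAt (suc a + c) h m + F (suc h) m + down F h m
    F-rec h m = begin
      L h m + V h m
        ≡⟨ cong (L h m +_) (paths-⋆-rec a h g m) ⟩
      L h m + (iverson (h ≡ᵇ a) * g m + V (suc h) m + down V h m)
        ≡⟨ x+[y+z+w]≡x+y+z+w (L h m) _ _ _ ⟩
      L h m + iverson (h ≡ᵇ a) * g m + V (suc h) m + down V h m
        ≡⟨ cong (λ x → x + V (suc h) m + down V h m) (lift-paths-rec a c h m) ⟩
      endsAt (suc a + c) h m + L (suc h) m + down L h m + V (suc h) m + down V h m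
        ≡⟨ regroup (endsAt (suc a + c) h m) (L (suc h) m) (down L h m) (V (suc h) m) (down V h m) ⟩
      endsAt (suc a + c) h m + F (suc h) m + (down L h m + down V h m)
        ≡⟨ cong (endsAt (suc a + c) h m + F (suc h) m +_) (down-+ L V h m) ⟨
      endsAt (suc a + c) h m + F (suc h) m + down F h m
        ∎
      where
      x+[y+z+w]≡x+y+z+w : ∀ x y z w → x + (y + z + w) ≡ x + y + z + w
      x+[y+z+w]≡x+y+z+w = solve-∀
      regroup : ∀ x y z u v → x + y + z + u + v ≡ x + (y + u) + (z + v)
      regroup = solve-∀
    F-vanish : ∀ h m → k * m + (suc a + c) < h → F h m ≡ 0
    F-vanish h m X<h = cong₂ _+_ lifted (∑-zero (suc m) λ j j≤m → cong (_* g (m ∸ j)) (paths-vanish a h j (reach j (s≤s⁻¹ j≤m))))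
      where
      reach : ∀ j → j ≤ m → k * j + a < h
      reach j j≤m = ≤-<-trans (+-mono-≤ (*-monoʳ-≤ k j≤m) (≤-trans (n≤1+n a) (m≤m+n (suc a) c))) X<h
      lifted : L h m ≡ 0
      lifted = trans (lift-≥ (suc a) (paths c) h m (≤-trans (s≤s (m≤m+n a c)) (≤-trans (m≤n+m (suc a + c) (k * m)) (<⇒≤ X<h))))
                     (paths-vanish c (h ∸ suc a) m (m+n≤o⇒m≤o∸n (suc (k * m + c)) (subst (_< h) (shuffle (k * m) a c) X<h)))
        where
        shuffle : ∀ x a c → x + (suc a + c) ≡ x + c + suc a
        shuffle = solve-∀

  paths⁻ : ℕ → ℕ → ℕ → ℕ
  paths⁻ zero    h n = 0
  paths⁻ (suc b) h n = paths b h n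

  pathsThenDown : ℕ → ℕ → ℕ → ℕ
  pathsThenDown b h zero    = 0
  pathsThenDown b h (suc n) = paths (b + d) h n

  paths⁻-rec : ∀ b h n → paths⁻ b h n ≡ endsAt b (suc h) n + paths⁻ b (suc h) n + down (paths⁻ b) h n
  paths⁻-rec zero    h zero    = refl
  paths⁻-rec zero    h (suc n) = sym (down-vanish {paths⁻ 0} h (suc n) λ _ → refl)
  paths⁻-rec (suc b) h zero    = paths-rec b h 0
  paths⁻-rec (suc b) h (suc n) = paths-rec b h (suc n)

  paths⁻-vanish : ∀ b h n → k * n + b < h → paths⁻ b h n ≡ 0
  paths⁻-vanish zero    h n _   = refl
  paths⁻-vanish (suc b) h n X<h = paths-vanish b h n (<-trans (+-monoʳ-< (k * n) (n<1+n b)) X<h)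

  endsAt-after-down : ∀ b h n → endsAt (b + d) h n ≡ down (endsAt b) h (suc n)
  endsAt-after-down b h (suc n) = sym (down-vanish {endsAt b} h (suc (suc n)) λ _ → refl)
  endsAt-after-down b h zero with d ≤? h
  ... | yes d≤h with m≤n⇒∃[o]m+o≡n d≤h
  ...   | x , refl = begin
    endsAt (b + d) (d + x) 0 ≡⟨ cong (λ t → endsAt t (d + x) 0) (+-comm b d) ⟩
    endsAt (d + b) (d + x) 0 ≡⟨ endsAt-lift d b x 0 ⟩
    endsAt b x 0             ≡⟨ cong (λ y → endsAt b y 0) (m+n∸m≡n d x) ⟨
    endsAt b (d + x ∸ d) 0   ≡⟨ down-≥ (endsAt b) (d + x) 0 d≤h ⟨
    down (endsAt b) (d + x) 1 ∎
  endsAt-after-down b h zero | no d≰h = begin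
    iverson (h ≡ᵇ b + d)     ≡⟨ cong iverson (dec-false (h ≟ b + d) (<⇒≢ (<-≤-trans (≰⇒> d≰h) (m≤n+m d b)))) ⟩
    0                        ≡⟨ down-< (endsAt b) h 0 (≰⇒> d≰h) ⟨
    down (endsAt b) h 1      ∎

  pathsThenDown-rec : ∀ b h n → pathsThenDown b h n ≡ down (endsAt b) h n + pathsThenDown b (suc h) n + down (pathsThenDown b) h n
  pathsThenDown-rec b h zero    = refl
  pathsThenDown-rec b h (suc n) = trans (paths-rec (b + d) h n)
    (cong₂ (λ x y → x + paths (b + d) (suc h) n + y) (endsAt-after-down b h n) (downs n))
    where
    downs : ∀ n → down (paths (b + d)) h n ≡ down (pathsThenDown b) h (suc n)
    downs zero    = sym (down-vanish {pathsThenDown b} h 1 λ _ → refl)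
    downs (suc n) = refl

  last-step : ∀ b h n → paths b h n ≡ endsAt b h n + paths⁻ b h n + pathsThenDown b h n
  last-step b h n = sym (paths-unique b F F-rec F-vanish h n)
    where
    E = endsAt b
    P = paths⁻ b
    T = pathsThenDown b
    F : ℕ → ℕ → ℕ
    F h n = E h n + P h n + T h n
    F-rec : ∀ h n → F h n ≡ E h n + F (suc h) n + down F h n
    F-rec h n = begin
      E h n + P h n + T h n
        ≡⟨ cong₂ (λ x y → E h n + x + y) (paths⁻-rec b h n) (pathsThenDown-rec b h n) ⟩
      E h n + (E (suc h) n + P (suc h) n + down P h n) + (down E h n + T (suc h) n + down T h n)
        ≡⟨ regroup (E h n) (E (suc h) n) (P (suc h) n) (down P h n) (down E h n) (T (suc h) n) (down T h n) ⟩
      E h n + F (suc h) n + (down E h n + down P h n + down T h n)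
        ≡⟨ cong (E h n + F (suc h) n +_) (trans (down-+ (λ h n → E h n + P h n) T h n) (cong (_+ down T h n) (down-+ E P h n))) ⟨
      E h n + F (suc h) n + down F h n
        ∎
      where
      regroup : ∀ x y z u v w t → x + (y + z + u) + (v + w + t) ≡ x + (y + z + w) + (v + u + t)
      regroup = solve-∀
    F-vanish : ∀ h n → k * n + b < h → F h n ≡ 0
    F-vanish h n X<h = cong₂ _+_ (cong₂ _+_ (ends-off (λ _ → true) b h n (>⇒≢ X<h)) (paths⁻-vanish b h n X<h)) (then-down n X<h)
      where
      then-down : ∀ n → k * n + b < h → pathsThenDown b h n ≡ 0
      then-down zero    _   = refl
      then-down (suc n) X<h = paths-vanish (b + d) h n
        (<-trans (subst (_< suc (k * n + b + d)) (+-assoc (k * n) b d) (n<1+n _)) (subst (_< h) (reach-suc n b) X<h))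

  paths-up : ∀ b → paths b 0 0 ≡ 1
  paths-up zero    = last-step 0 0 0
  paths-up (suc b) = trans (last-step (suc b) 0 0) (trans (+-identityʳ _) (paths-up b))

  C-step : ∀ m Y → k * m + d ≡ Y → d * (Y C m) ≡ Y C suc m
  C-step m Y refl = sym (*-cancelˡ-≡ (Y C suc m) (d * (Y C m)) (suc m)
    (+-cancelʳ-≡ (m * (Y C m)) (suc m * (Y C suc m)) (suc m * (d * (Y C m)))
      (trans (C-ratio Y m) (ring e m (Y C m)))))
    where
    ring : ∀ e m c → ((2 + e) * m + suc e) * c ≡ suc m * (suc e * c) + m * c
    ring = solve-∀

  ballot : ∀ X m b → k * m + b ≡ X → paths b 0 m + d * Cprev X m ≡ X C m
  ballot X       zero    b _  = cong₂ _+_ (paths-up b) (*-zeroʳ d)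
  ballot zero    (suc m) b eq = ⊥-elim (0≢1+n (trans (sym eq) (reach-suc m b)))
  ballot (suc Y) (suc m) zero eq = begin
    paths 0 0 (suc m) + d * (suc Y C m)                   ≡⟨ cong₂ _+_ (last-step 0 0 (suc m)) (cong (d *_) (Cprev-pascal Y m)) ⟩
    paths d 0 m + d * (Cprev Y m + Y C m)                 ≡⟨ cong (paths d 0 m +_) (*-distribˡ-+ d (Cprev Y m) (Y C m)) ⟩
    paths d 0 m + (d * Cprev Y m + d * (Y C m))           ≡⟨ +-assoc (paths d 0 m) _ _ ⟨
    paths d 0 m + d * Cprev Y m + d * (Y C m)             ≡⟨ cong₂ _+_ (ballot Y m d Y≡X) (C-step m Y Y≡X) ⟩
    Y C m + Y C suc m                                     ≡⟨ C-pascal Y m ⟨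
    suc Y C suc m                                         ∎
    where
    Y≡X : k * m + d ≡ Y
    Y≡X = trans (cong (_+ d) (sym (+-identityʳ (k * m)))) (suc-injective (trans (sym (reach-suc m 0)) eq))
  ballot (suc Y) (suc m) (suc b) eq = begin
    paths (suc b) 0 (suc m) + d * (suc Y C m)
      ≡⟨ cong₂ _+_ (last-step (suc b) 0 (suc m)) (cong (d *_) (Cprev-pascal Y m)) ⟩
    paths b 0 (suc m) + paths (suc b + d) 0 m + d * (Cprev Y m + Y C m)
      ≡⟨ cong (paths b 0 (suc m) + paths (suc b + d) 0 m +_) (*-distribˡ-+ d (Cprev Y m) (Y C m)) ⟩
    paths b 0 (suc m) + paths (suc b + d) 0 m + (d * Cprev Y m + d * (Y C m))
      ≡⟨ regroup (paths b 0 (suc m)) _ _ _ ⟩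
    (paths (suc b + d) 0 m + d * Cprev Y m) + (paths b 0 (suc m) + d * (Y C m))
      ≡⟨ cong₂ _+_ (ballot Y m (suc b + d) later) (ballot Y (suc m) b (suc-injective (trans (sym (+-suc _ b)) eq))) ⟩
    Y C m + Y C suc m
      ≡⟨ C-pascal Y m ⟨
    suc Y C suc m
      ∎
    where
    regroup : ∀ p q r s → p + q + (r + s) ≡ (q + r) + (p + s)
    regroup = solve-∀
    later : k * m + (suc b + d) ≡ Y
    later = trans (sym (+-assoc (k * m) (suc b) d)) (suc-injective (trans (sym (reach-suc m (suc b))) eq))

  C-fuss : ∀ m → (k * m + 1) C m ≡ paths 0 0 m * suc (k * m)
  C-fuss zero    = sym (cong₂ _*_ (paths-up 0) (cong suc (*-zeroʳ k)))
  C-fuss (suc m) = begin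
    (X + 1) C M              ≡⟨ cong (_C M) (+-comm X 1) ⟩
    suc X C suc m            ≡⟨ C-pascal X m ⟩
    c + W                    ≡⟨ cong (c +_) ballot-X ⟨
    c + (n₀ + d * c)         ≡⟨ x+[y+z*x]≡y+[1+z]*x c n₀ d ⟩
    n₀ + k * c               ≡⟨ cong (λ z → n₀ + k * z) n₀*M≡c ⟨
    n₀ + k * (n₀ * M)        ≡⟨ y+k*[y*M]≡y*[1+k*M] n₀ k M ⟩
    n₀ * suc X               ∎
    where
    M = suc m
    X = k * M
    c = X C m
    W = X C M
    n₀ = paths 0 0 M
    ballot-X : n₀ + d * c ≡ W
    ballot-X = ballot X M 0 (+-identityʳ X)
    -- (m+1) C(X, m+1) = (X − m) C(X, m) with X − m = (k−1)(m+1) + 1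
    M*W : M * W ≡ d * M * c + c
    M*W = +-cancelʳ-≡ (m * c) (M * W) (d * M * c + c) (trans (C-ratio X m) (ring e m c))
      where
      ring : ∀ e m c → (2 + e) * suc m * c ≡ suc e * suc m * c + c + m * c
      ring = solve-∀
    n₀*M≡c : n₀ * M ≡ c
    n₀*M≡c = +-cancelʳ-≡ (d * M * c) (n₀ * M) c (begin
      n₀ * M + d * M * c  ≡⟨ ring n₀ M d c ⟩
      M * (n₀ + d * c)    ≡⟨ cong (M *_) ballot-X ⟩
      M * W               ≡⟨ M*W ⟩
      d * M * c + c       ≡⟨ +-comm (d * M * c) c ⟩
      c + d * M * c       ∎)
      where
      ring : ∀ n₀ M d c → n₀ * M + d * M * c ≡ M * (n₀ + d * c)
      ring = solve-∀
    x+[y+z*x]≡y+[1+z]*x : ∀ x y z → x + (y + z * x) ≡ y + suc z * x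
    x+[y+z*x]≡y+[1+z]*x = solve-∀
    y+k*[y*M]≡y*[1+k*M] : ∀ y k M → y + k * (y * M) ≡ y * suc (k * M)
    y+k*[y*M]≡y*[1+k*M] = solve-∀

  fuss≡paths : ∀ m → fuss k m ≡ paths 0 0 m
  fuss≡paths m = trans (cong (_/ suc (k * m)) (C-fuss m)) (m*n/n≡m (paths 0 0 m) (suc (k * m)))

  R≡paths : ∀ r m → R k (suc r) m ≡ paths r 0 m
  R≡paths zero    m = trans (R-suc k 0 m) (trans (⋆-R₀ k (fuss k) m) (fuss≡paths m))
  R≡paths (suc r) m = begin
    R k (suc (suc r)) m           ≡⟨ R-suc k (suc r) m ⟩
    (fuss k ⋆ R k (suc r)) m      ≡⟨ ⋆-cong fuss≡paths (R≡paths r) m ⟩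
    (paths 0 0 ⋆ paths r 0) m     ≡⟨ last-visit 0 r 0 m ⟨
    paths (suc r) 0 m             ∎

  R-+ : ∀ x y m → R k (x + y) m ≡ (R k x ⋆ R k y) m
  R-+ zero    y       m = sym (R₀-⋆ k (R k y) m)
  R-+ (suc x) zero    m = trans (cong (λ r → R k r m) (+-identityʳ (suc x))) (sym (⋆-R₀ k (R k (suc x)) m))
  R-+ (suc x) (suc y) m = begin
    R k (suc x + suc y) m                 ≡⟨ R≡paths (x + suc y) m ⟩
    paths (x + suc y) 0 m                 ≡⟨ cong (λ b → paths b 0 m) (+-suc x y) ⟩
    paths (suc x + y) 0 m                 ≡⟨ last-visit x y 0 m ⟩
    (paths x 0 ⋆ paths y 0) m             ≡⟨ ⋆-cong (sym ∘ R≡paths x) (sym ∘ R≡paths y) m ⟩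
    (R k (suc x) ⋆ R k (suc y)) m         ∎

  atGround : (ℕ → ℕ → ℕ) → ℕ → ℕ → ℕ
  atGround F h zero    = 0
  atGround F h (suc m) = iverson (h ≡ᵇ e) * F 0 m

  -- A down step from h + 1 lands on the ground exactly when h = k − 2; otherwise it is a lifted down step from h.
  down-suc : ∀ F h n → down F (suc h) n ≡ atGround F h n + down (λ h′ → F (suc h′)) h n
  down-suc F h zero    = refl
  down-suc F h (suc m) with <-cmp h e
  ... | tri< h<e _ _ = begin
    down F (suc h) (suc m)     ≡⟨ down-< F (suc h) m (s<s h<e) ⟩
    0 + 0                      ≡⟨ cong₂ _+_ (cong (λ c → iverson c * F 0 m) (dec-false (h ≟ e) (<⇒≢ h<e)))
                                            (down-< (λ h′ → F (suc h′)) h m (m<n⇒m<1+n h<e)) ⟨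
    iverson (h ≡ᵇ e) * F 0 m + down (λ h′ → F (suc h′)) h (suc m) ∎
  ... | tri≈ _ refl _ = begin
    down F d (suc m)           ≡⟨ down-≥ F d m ≤-refl ⟩
    F (d ∸ d) m                ≡⟨ cong (λ h → F h m) (n∸n≡0 d) ⟩
    F 0 m                      ≡⟨ trans (+-identityʳ (F 0 m + 0)) (+-identityʳ (F 0 m)) ⟨
    F 0 m + 0 + 0
      ≡⟨ cong₂ (λ c x → iverson c * F 0 m + x) (dec-true (e ≟ e) refl) (down-< (λ h′ → F (suc h′)) e m (n<1+n e)) ⟨
    iverson (e ≡ᵇ e) * F 0 m + down (λ h′ → F (suc h′)) e (suc m) ∎
  ... | tri> _ _ e<h = begin
    down F (suc h) (suc m)     ≡⟨ down-≥ F (suc h) m (m≤n⇒m≤1+n e<h) ⟩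
    F (suc h ∸ d) m            ≡⟨ cong (λ h → F h m) (+-∸-assoc 1 e<h) ⟩
    F (suc (h ∸ d)) m          ≡⟨ down-≥ (λ h′ → F (suc h′)) h m e<h ⟨
    down (λ h′ → F (suc h′)) h (suc m)
      ≡⟨ cong (λ c → iverson c * F 0 m + down (λ h′ → F (suc h′)) h (suc m)) (dec-false (h ≟ e) (>⇒≢ e<h)) ⟨
    iverson (h ≡ᵇ e) * F 0 m + down (λ h′ → F (suc h′)) h (suc m) ∎

  count-rec-suc : ∀ P b h n → count P b (suc h) n ≡
    ends P b (suc h) n + count P b (suc (suc h)) n + atGround (λ h′ n′ → count (arrive h′ P) b h′ n′) h n
      + down (λ h′ → count P b (suc h′)) h n
  count-rec-suc P b h n =
    trans (count-rec P b (suc h) n)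
      (trans (cong (ends P b (suc h) n + count P b (suc (suc h)) n +_) (down-suc (λ h′ n′ → count (arrive h′ P) b h′ n′) h n))
             (sym (+-assoc (ends P b (suc h) n + count P b (suc (suc h)) n) _ _)))

  count-false : ∀ b h n → count (λ _ → false) b h n ≡ 0
  count-false b h n = sum-map-zero (λ _ → refl) (allPaths (k * n + b ∸ h))

  -- Starting above the ground, a path without returns never touches it.
  no-return : ∀ b h n → pathsᵣ 0 b (suc h) n ≡ paths⁻ b h n
  no-return b = height-induction b (λ h n → pathsᵣ 0 b (suc h) n ≡ paths⁻ b h n)
    (λ h n X<h → trans (count-vanish (_≡ᵇ 0) b (suc h) n (m<n⇒m<1+n X<h)) (sym (paths⁻-vanish b h n X<h)))
    λ h n above below → begin
      pathsᵣ 0 b (suc h) n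
        ≡⟨ count-rec-suc (_≡ᵇ 0) b h n ⟩
      endsAt b (suc h) n + pathsᵣ 0 b (suc (suc h)) n + atGround (λ h′ n′ → count (arrive h′ (_≡ᵇ 0)) b h′ n′) h n
        + down (λ h′ → pathsᵣ 0 b (suc h′)) h n
        ≡⟨ cong₂ (λ x y → endsAt b (suc h) n + x + y + down (λ h′ → pathsᵣ 0 b (suc h′)) h n) above (ground n) ⟩
      endsAt b (suc h) n + paths⁻ b (suc h) n + 0 + down (λ h′ → pathsᵣ 0 b (suc h′)) h n
        ≡⟨ cong₂ _+_ (+-identityʳ _) (down-cong h n below) ⟩
      endsAt b (suc h) n + paths⁻ b (suc h) n + down (paths⁻ b) h n
        ≡⟨ paths⁻-rec b h n ⟨
      paths⁻ b h n
        ∎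
    where
    ground : ∀ {h} n → atGround (λ h′ n′ → count (arrive h′ (_≡ᵇ 0)) b h′ n′) h n ≡ 0
    ground {h} zero    = refl
    ground {h} (suc m) = trans (cong (iverson (h ≡ᵇ e) *_) (count-false b 0 m)) (*-zeroʳ (iverson (h ≡ᵇ e)))

  afterReturn : ℕ → ℕ → ℕ → ℕ → ℕ
  afterReturn ρ b h zero    = 0
  afterReturn ρ b h (suc m) = (paths e h ⋆ pathsᵣ ρ b 0) m

  afterReturn-rec : ∀ ρ b h n → afterReturn ρ b h n ≡
    afterReturn ρ b (suc h) n + atGround (λ h′ n′ → count (arrive h′ (_≡ᵇ suc ρ)) b h′ n′) h n + down (afterReturn ρ b) h n
  afterReturn-rec ρ b h zero    = refl
  afterReturn-rec ρ b h (suc m) = begin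
    (paths e h ⋆ g) m
      ≡⟨ paths-⋆-rec e h g m ⟩
    iverson (h ≡ᵇ e) * g m + (paths e (suc h) ⋆ g) m + down (λ h′ m′ → (paths e h′ ⋆ g) m′) h m
      ≡⟨ cong₂ _+_ (+-comm (iverson (h ≡ᵇ e) * g m) _) (downs m) ⟩
    (paths e (suc h) ⋆ g) m + iverson (h ≡ᵇ e) * g m + down (afterReturn ρ b) h (suc m)
      ∎
    where
    g = pathsᵣ ρ b 0
    downs : ∀ m → down (λ h′ m′ → (paths e h′ ⋆ g) m′) h m ≡ down (afterReturn ρ b) h (suc m)
    downs zero    = sym (down-vanish {afterReturn ρ b} h 1 λ _ → refl)
    downs (suc m) = refl

  reach-down : ∀ j m b → j ≤ m → k * j + e < k * suc m + b
  reach-down j m b j≤m =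
    <-≤-trans (+-monoʳ-< (k * j) (n<1+n e))
      (≤-trans (+-monoˡ-≤ d (*-monoʳ-≤ k j≤m))
        (≤-trans (+-monoˡ-≤ d (m≤m+n (k * m) b)) (≤-trans (n≤1+n _) (≤-reflexive (sym (reach-suc m b))))))

  -- Up to its first return, a path from h + 1 is a lifted path from h to k − 2.
  first-return : ∀ ρ b h n → pathsᵣ (suc ρ) b (suc h) n ≡ afterReturn ρ b h n
  first-return ρ b = height-induction b (λ h n → pathsᵣ (suc ρ) b (suc h) n ≡ afterReturn ρ b h n)
    (λ h n X<h → trans (count-vanish (_≡ᵇ suc ρ) b (suc h) n (m<n⇒m<1+n X<h)) (sym (vanish h n X<h)))
    λ h n above below → begin
      pathsᵣ (suc ρ) b (suc h) n
        ≡⟨ count-rec-suc (_≡ᵇ suc ρ) b h n ⟩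
      pathsᵣ (suc ρ) b (suc (suc h)) n + atGround (λ h′ n′ → count (arrive h′ (_≡ᵇ suc ρ)) b h′ n′) h n
        + down (λ h′ → pathsᵣ (suc ρ) b (suc h′)) h n
        ≡⟨ cong₂ (λ x y → x + atGround (λ h′ n′ → count (arrive h′ (_≡ᵇ suc ρ)) b h′ n′) h n + y) above (down-cong h n below) ⟩
      afterReturn ρ b (suc h) n + atGround (λ h′ n′ → count (arrive h′ (_≡ᵇ suc ρ)) b h′ n′) h n + down (afterReturn ρ b) h n
        ≡⟨ afterReturn-rec ρ b h n ⟨
      afterReturn ρ b h n
        ∎
    where
    vanish : ∀ h n → k * n + b < h → afterReturn ρ b h n ≡ 0
    vanish h zero    _   = refl
    vanish h (suc m) X<h = ∑-zero (suc m) λ j j≤m →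
      cong (_* pathsᵣ ρ b 0 (m ∸ j)) (paths-vanish e h j (<-trans (reach-down j m b (s≤s⁻¹ j≤m)) X<h))

  pathsᵣ-ground : ∀ ρ b n → pathsᵣ ρ b 0 n ≡ ends (_≡ᵇ ρ) b 0 n + pathsᵣ ρ b 1 n
  pathsᵣ-ground ρ b n = trans (count-rec (_≡ᵇ ρ) b 0 n)
    (trans (cong (ends (_≡ᵇ ρ) b 0 n + pathsᵣ ρ b 1 n +_)
                 (down-vanish {λ h′ n′ → count (arrive h′ (_≡ᵇ ρ)) b h′ n′} 0 n (atDown 0 n λ ())))
           (+-identityʳ _))

  -- Every return uses a down step.
  pathsᵣ-few : ∀ ρ b h n → n < ρ → pathsᵣ ρ b h n ≡ 0
  pathsᵣ-few (suc ρ) b h n n<ρ = from h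
    where
    after : ∀ h n → n < suc ρ → afterReturn ρ b h n ≡ 0
    after h zero    _         = refl
    after h (suc m) (s≤s m<ρ) = ∑-zero (suc m) λ j _ →
      trans (cong (paths e h j *_) (pathsᵣ-few ρ b 0 (m ∸ j) (≤-<-trans (m∸n≤m m j) m<ρ))) (*-zeroʳ (paths e h j))
    above : ∀ h → pathsᵣ (suc ρ) b (suc h) n ≡ 0
    above h = trans (first-return ρ b h n) (after h n n<ρ)
    from : ∀ h → pathsᵣ (suc ρ) b h n ≡ 0
    from zero    = trans (pathsᵣ-ground (suc ρ) b n) (above 0)
    from (suc h) = above h

  pathsᵣ≡⋆R : ∀ ρ b h t → pathsᵣ (suc ρ) b (suc h) (suc ρ + t) ≡ (paths e h ⋆ R k (b + ρ * d)) t
  pathsᵣ-ground≡R : ∀ ρ b t → pathsᵣ ρ b 0 (ρ + t) ≡ R k (b + ρ * d) t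

  pathsᵣ≡⋆R ρ b h t = begin
    pathsᵣ (suc ρ) b (suc h) (suc ρ + t)            ≡⟨ first-return ρ b h (suc ρ + t) ⟩
    (paths e h ⋆ pathsᵣ ρ b 0) (ρ + t)              ≡⟨ ⋆-shift (paths e h) (pathsᵣ ρ b 0) ρ t (λ j j<ρ → pathsᵣ-few ρ b 0 j j<ρ) ⟩
    (paths e h ⋆ (λ s → pathsᵣ ρ b 0 (ρ + s))) t    ≡⟨ ⋆-cong {f = paths e h} (λ _ → refl) (pathsᵣ-ground≡R ρ b) t ⟩
    (paths e h ⋆ R k (b + ρ * d)) t                 ∎

  pathsᵣ-ground≡R zero b t = begin
    pathsᵣ 0 b 0 t                  ≡⟨ pathsᵣ-ground 0 b t ⟩
    endsAt b 0 t + pathsᵣ 0 b 1 t   ≡⟨ cong (endsAt b 0 t +_) (no-return b 0 t) ⟩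
    endsAt b 0 t + paths⁻ b 0 t     ≡⟨ from-ground b t ⟩
    R k (b + 0) t                   ∎
    where
    from-ground : ∀ b t → endsAt b 0 t + paths⁻ b 0 t ≡ R k (b + 0) t
    from-ground zero    zero    = refl
    from-ground zero    (suc t) = refl
    from-ground (suc b) zero    = trans (sym (R≡paths b 0)) (cong (λ r → R k r 0) (sym (+-identityʳ (suc b))))
    from-ground (suc b) (suc t) = trans (sym (R≡paths b (suc t))) (cong (λ r → R k r (suc t)) (sym (+-identityʳ (suc b))))
  pathsᵣ-ground≡R (suc ρ) b t = begin
    pathsᵣ (suc ρ) b 0 (suc ρ + t)        ≡⟨ pathsᵣ-ground (suc ρ) b (suc ρ + t) ⟩
    pathsᵣ (suc ρ) b 1 (suc ρ + t)        ≡⟨ pathsᵣ≡⋆R ρ b 0 t ⟩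
    (paths e 0 ⋆ R k (b + ρ * d)) t       ≡⟨ ⋆-cong {g = R k (b + ρ * d)} (sym ∘ R≡paths e) (λ _ → refl) t ⟩
    (R k d ⋆ R k (b + ρ * d)) t           ≡⟨ R-+ d (b + ρ * d) t ⟨
    R k (d + (b + ρ * d)) t               ≡⟨ cong (λ r → R k r t) (x+[y+z]≡y+[x+z] d b (ρ * d)) ⟩
    R k (b + suc ρ * d) t                 ∎
    where
    x+[y+z]≡y+[x+z] : ∀ x y z → x + (y + z) ≡ y + (x + z)
    x+[y+z]≡y+[x+z] = solve-∀

  Cρ-no-return : ∀ α β n → Cρ k n (suc α) β 0 ≡ paths⁻ β α n
  Cρ-no-return α β n = trans (Cρ≡pathsᵣ n (suc α) β 0) (no-return β α n)

  Cρ-returns : ∀ α β ρ n → Cρ k n (suc α) β (suc ρ) ≡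
    sum (map (λ i → Cn k i α e * R k (β + ρ * d) (n ∸ suc ρ ∸ i)) (upTo (suc n ∸ suc ρ)))
  Cρ-returns α β ρ n with suc ρ ≤? n
  ... | yes ρ<n = begin
    Cρ k n (suc α) β (suc ρ)                              ≡⟨ Cρ≡pathsᵣ n (suc α) β (suc ρ) ⟩
    pathsᵣ (suc ρ) β (suc α) n                            ≡⟨ cong (pathsᵣ (suc ρ) β (suc α)) (m+[n∸m]≡n ρ<n) ⟨
    pathsᵣ (suc ρ) β (suc α) (suc ρ + (n ∸ suc ρ))        ≡⟨ pathsᵣ≡⋆R ρ β α (n ∸ suc ρ) ⟩
    (paths e α ⋆ R k (β + ρ * d)) (n ∸ suc ρ)
      ≡⟨ ⋆-cong {g = R k (β + ρ * d)} (λ i → sym (Cn≡paths i α e)) (λ _ → refl) (n ∸ suc ρ) ⟩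
    ((λ i → Cn k i α e) ⋆ R k (β + ρ * d)) (n ∸ suc ρ)    ≡⟨ ⋆-as-sum (λ i → Cn k i α e) (R k (β + ρ * d)) (suc ρ) n ρ<n ⟨
    sum (map (λ i → Cn k i α e * R k (β + ρ * d) (n ∸ suc ρ ∸ i)) (upTo (suc n ∸ suc ρ))) ∎
  ... | no n≤ρ = begin
    Cρ k n (suc α) β (suc ρ)        ≡⟨ Cρ≡pathsᵣ n (suc α) β (suc ρ) ⟩
    pathsᵣ (suc ρ) β (suc α) n      ≡⟨ pathsᵣ-few (suc ρ) β (suc α) n (≰⇒> n≤ρ) ⟩
    0                               ≡⟨ cong (λ l → sum (map (λ i → Cn k i α e * R k (β + ρ * d) (n ∸ suc ρ ∸ i)) (upTo l)))
                                            (m≤n⇒m∸n≡0 (≰⇒> n≤ρ)) ⟨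
    sum (map (λ i → Cn k i α e * R k (β + ρ * d) (n ∸ suc ρ ∸ i)) (upTo (suc n ∸ suc ρ))) ∎

-- Opened only here: its prefix +_ would make the sections (x +_) above ambiguous.
open import Data.Integer using (+_; _-_)

theorem3p10 : (k β n ρ α : ℕ) → 2 ≤ k → α > 0 →
    (ρ ≡ 0 → Cρ k n α β ρ ≡ Cz k n (+ α - + 1) (+ β - + 1)) ×
    (ρ > 0 → Cρ k n α β ρ ≡
      sum (map (λ i → Cn k i (α ∸ 1) (k ∸ 2) * R k (β + (ρ ∸ 1) * (k ∸ 1)) (n ∸ ρ ∸ i))
               (upTo (suc n ∸ ρ))))
theorem3p10 .(2 + e) β n ρ .(suc α) (s≤s (s≤s (z≤n {e}))) (s≤s (z≤n {α})) = without-returns ρ , with-returns ρ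
  where
  open Paths e
  without-returns : ∀ ρ → ρ ≡ 0 → Cρ k n (suc α) β ρ ≡ Cz k n (+ α) (+ β - + 1)
  without-returns .0 refl = trans (Cρ-no-return α β n) (lowered β)
    where
    lowered : ∀ β → paths⁻ β α n ≡ Cz k n (+ α) (+ β - + 1)
    lowered zero    = refl
    lowered (suc β) = sym (Cn≡paths n α β)
  with-returns : ∀ ρ → ρ > 0 → Cρ k n (suc α) β ρ ≡
    sum (map (λ i → Cn k i α e * R k (β + (ρ ∸ 1) * d) (n ∸ ρ ∸ i)) (upTo (suc n ∸ ρ)))
  with-returns (suc ρ) _ = Cρ-returns α β ρ n
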